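{- Let $G_{243,22}=\{x\in\mathbb{F}_{243}:x^{22}=1\}$. The $11$ cosets of $G_{243,22}$ in $\mathbb{F}_{243}^\times$ form a partition of $\mathbb{F}_{243}^\times$ into $11$ complete cap sets of size $22$.
   Context: For $q=3^m$, a subset $S\subseteq\mathbb{F}_q$ is a cap set if there are no pairwise distinct $a,b,c\in S$ with $a+b+c=0$. A cap set $S$ is complete if it is not contained in any strictly larger cap set, equivalently, for every $x\in\mathbb{F}_q\setminus S$ there exist distinct $y,z\in S$ with $x+y+z=0$. -}

module Defs where

open import Data.Nat using (ℕ; zero; suc)
open import Data.Fin using (Fin)
open import Data.List using (List; length)
open import Data.List.Membership.Propositional using (_∈_)
open import Data.List.Relation.Unary.Unique.Propositional using (Unique)
open import Data.Product using (Σ; ∃; _×_; _,_)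
open import Data.Empty using (⊥)
open import Relation.Nullary using (¬_)
open import Relation.Binary.PropositionalEquality using (_≡_; _≢_)
open import Function.Bundles using (_⇔_)

data F₃ : Set where
  z0 z1 z2 : F₃

infixl 6 _⊕_
infixl 7 _⊗_

_⊕_ : F₃ → F₃ → F₃
z0 ⊕ y  = y
z1 ⊕ z0 = z1
z1 ⊕ z1 = z2
z1 ⊕ z2 = z0
z2 ⊕ z0 = z2
z2 ⊕ z1 = z0
z2 ⊕ z2 = z1

_⊗_ : F₃ → F₃ → F₃
z0 ⊗ y  = z0
z1 ⊗ y  = y
z2 ⊗ z0 = z0
z2 ⊗ z1 = z2
z2 ⊗ z2 = z1

-- The field F₂₄₃ = F₃[t] / (t⁵ + 2t + 1)   (t⁵ + 2t + 1 is irreducible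
-- over F₃; it is the Conway polynomial for 3⁵).  An element
-- c₀ + c₁ t + c₂ t² + c₃ t³ + c₄ t⁴ is represented by its coefficients.

record F243 : Set where
  constructor el
  field
    c0 c1 c2 c3 c4 : F₃

open F243 public

𝟘 : F243
𝟘 = el z0 z0 z0 z0 z0

𝟙 : F243
𝟙 = el z1 z0 z0 z0 z0

infixl 6 _+_
infixl 7 _*_

_+_ : F243 → F243 → F243
el a0 a1 a2 a3 a4 + el b0 b1 b2 b3 b4 =
  el (a0 ⊕ b0) (a1 ⊕ b1) (a2 ⊕ b2) (a3 ⊕ b3) (a4 ⊕ b4)

-- Multiplication: multiply polynomials, then reduce using
-- t⁵ = t + 2, t⁶ = t² + 2t, t⁷ = t³ + 2t², t⁸ = t⁴ + 2t³.
_*_ : F243 → F243 → F243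
el a0 a1 a2 a3 a4 * el b0 b1 b2 b3 b4 =
  el (p0 ⊕ z2 ⊗ p5)
     (p1 ⊕ p5 ⊕ z2 ⊗ p6)
     (p2 ⊕ p6 ⊕ z2 ⊗ p7)
     (p3 ⊕ p7 ⊕ z2 ⊗ p8)
     (p4 ⊕ p8)
  where
  p0 = a0 ⊗ b0
  p1 = a0 ⊗ b1 ⊕ a1 ⊗ b0
  p2 = a0 ⊗ b2 ⊕ a1 ⊗ b1 ⊕ a2 ⊗ b0
  p3 = a0 ⊗ b3 ⊕ a1 ⊗ b2 ⊕ a2 ⊗ b1 ⊕ a3 ⊗ b0
  p4 = a0 ⊗ b4 ⊕ a1 ⊗ b3 ⊕ a2 ⊗ b2 ⊕ a3 ⊗ b1 ⊕ a4 ⊗ b0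
  p5 = a1 ⊗ b4 ⊕ a2 ⊗ b3 ⊕ a3 ⊗ b2 ⊕ a4 ⊗ b1
  p6 = a2 ⊗ b4 ⊕ a3 ⊗ b3 ⊕ a4 ⊗ b2
  p7 = a3 ⊗ b4 ⊕ a4 ⊗ b3
  p8 = a4 ⊗ b4

infixr 8 _^_
_^_ : F243 → ℕ → F243
x ^ zero  = 𝟙
x ^ suc n = x * (x ^ n)

Subset : Set₁
Subset = F243 → Set

_⊆_ : Subset → Subset → Set
S ⊆ T = ∀ x → S x → T x

G : Subset
G x = x ^ 22 ≡ 𝟙

coset : F243 → Subset
coset a x = Σ F243 λ g → G g × x ≡ a * g

IsCapSet : Subset → Set
IsCapSet S = ∀ a b c → S a → S b → S c →
  a ≢ b → a ≢ c → b ≢ c → ¬ (a + b + c ≡ 𝟘)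

IsCompleteCapSet : Subset → Set₁
IsCompleteCapSet S = IsCapSet S × (∀ (T : Subset) → IsCapSet T → S ⊆ T → T ⊆ S)

HasSize : Subset → ℕ → Set
HasSize S n = Σ (List F243) λ xs → Unique xs × length xs ≡ n × (∀ x → S x ⇔ x ∈ xs)

-- G is the kernel of χ x = x²², so for a ≠ 0 the coset a·G is the fibre of χ
-- through a; the root t of the Conway polynomial t⁵ + 2t + 1 is primitive, so the
-- eleven fibres over F₂₄₃ˣ are those through 1, t, …, t¹⁰.  In characteristic 3
-- two distinct points x, y have a third point −(x + y) on their line, distinct
-- from both; hence a set is a cap iff it contains no third point of two of its
-- points, and it is complete iff every point outside it is such a third point.
-- Each fibre is a 22-element list, and these conditions are decided on it by
-- evaluation.
module Submission where

open import Defs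
open import Data.Fin using (Fin; toℕ)
import Data.Fin.Properties as Fin
open import Data.List using (List; []; _∷_; filter; length; map; cartesianProductWith)
open import Data.List.Membership.Propositional using (_∈_; find)
open import Data.List.Membership.Propositional.Properties
  using (∈-filter⁺; ∈-filter⁻; ∈-map⁺; ∈-map⁻; ∈-cartesianProductWith⁺)
open import Data.List.Relation.Unary.All as All using (All; all?)
open import Data.List.Relation.Unary.Any using (Any; here; there; any?)
open import Data.List.Relation.Unary.Unique.Propositional using (Unique)
import Data.Nat as ℕ
open import Data.Product using (Σ; ∃; _×_; _,_; proj₁; proj₂; swap)
import Data.Vec as Vec
open import Data.Vec.Properties using (lookup∘tabulate)
open import Function using (_$_)
open import Function.Bundles using (_⇔_; mk⇔; Equivalence)
open import Relation.Binary.Definitions using (DecidableEquality)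
open import Relation.Binary.PropositionalEquality using (_≡_; _≢_; refl; sym; trans; cong; subst)
open import Relation.Nullary using (Dec; yes; no; ¬_; ¬?)
open import Relation.Nullary.Decidable using (map′; _×-dec_; _→-dec_; from-yes; decidable-stable)
open import Relation.Unary using (Pred; Decidable; _≐_)

open Equivalence using (to; from)

infix 4 _≟₃_ _≟_
infix 8 -_

_≟₃_ : DecidableEquality F₃
z0 ≟₃ z0 = yes refl
z0 ≟₃ z1 = no λ ()
z0 ≟₃ z2 = no λ ()
z1 ≟₃ z0 = no λ ()
z1 ≟₃ z1 = yes refl
z1 ≟₃ z2 = no λ ()
z2 ≟₃ z0 = no λ ()
z2 ≟₃ z1 = no λ ()
z2 ≟₃ z2 = yes refl

_≟_ : DecidableEquality F243
el a0 a1 a2 a3 a4 ≟ el b0 b1 b2 b3 b4 =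
  map′ (λ { (refl , refl , refl , refl , refl) → refl })
       (λ { refl → refl , refl , refl , refl , refl })
       (a0 ≟₃ b0 ×-dec a1 ≟₃ b1 ×-dec a2 ≟₃ b2 ×-dec a3 ≟₃ b3 ×-dec a4 ≟₃ b4)

open import Data.List.Membership.DecPropositional _≟_ using (_∈?_)
open import Data.List.Relation.Unary.Unique.DecPropositional _≟_ using (unique?)

el-cong : ∀ {a0 a1 a2 a3 a4 b0 b1 b2 b3 b4} →
  a0 ≡ b0 → a1 ≡ b1 → a2 ≡ b2 → a3 ≡ b3 → a4 ≡ b4 →
  el a0 a1 a2 a3 a4 ≡ el b0 b1 b2 b3 b4
el-cong refl refl refl refl refl = refl

-_ : F243 → F243
- el a0 a1 a2 a3 a4 = el (z2 ⊗ a0) (z2 ⊗ a1) (z2 ⊗ a2) (z2 ⊗ a3) (z2 ⊗ a4)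

+-inverseʳ : ∀ x → x + - x ≡ 𝟘
+-inverseʳ (el a0 a1 a2 a3 a4) = el-cong (inv a0) (inv a1) (inv a2) (inv a3) (inv a4)
  where
  inv : ∀ a → a ⊕ z2 ⊗ a ≡ z0
  inv z0 = refl
  inv z1 = refl
  inv z2 = refl

x+y≡𝟘⇒y≡-x : ∀ x y → x + y ≡ 𝟘 → y ≡ - x
x+y≡𝟘⇒y≡-x (el a0 a1 a2 a3 a4) (el b0 b1 b2 b3 b4) eq =
  el-cong (neg a0 b0 (cong c0 eq)) (neg a1 b1 (cong c1 eq)) (neg a2 b2 (cong c2 eq))
          (neg a3 b3 (cong c3 eq)) (neg a4 b4 (cong c4 eq))
  where
  neg : ∀ a b → a ⊕ b ≡ z0 → b ≡ z2 ⊗ a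
  neg z0 z0 _ = refl
  neg z1 z2 _ = refl
  neg z2 z1 _ = refl
  neg z0 z1 ()
  neg z0 z2 ()
  neg z1 z0 ()
  neg z1 z1 ()
  neg z2 z0 ()
  neg z2 z2 ()

y≡-[x+y]⇒x≡y : ∀ x y → y ≡ - (x + y) → x ≡ y
y≡-[x+y]⇒x≡y (el a0 a1 a2 a3 a4) (el b0 b1 b2 b3 b4) eq =
  el-cong (collapse a0 b0 (cong c0 eq)) (collapse a1 b1 (cong c1 eq)) (collapse a2 b2 (cong c2 eq))
          (collapse a3 b3 (cong c3 eq)) (collapse a4 b4 (cong c4 eq))
  where
  collapse : ∀ a b → b ≡ z2 ⊗ (a ⊕ b) → a ≡ b
  collapse z0 z0 _ = refl
  collapse z1 z1 _ = refl
  collapse z2 z2 _ = refl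
  collapse z0 z1 ()
  collapse z0 z2 ()
  collapse z1 z0 ()
  collapse z1 z2 ()
  collapse z2 z0 ()
  collapse z2 z1 ()

Enumerates : List F243 → Subset → Set
Enumerates xs S = ∀ x → S x ⇔ x ∈ xs

LineFree : Subset → List F243 → Set
LineFree S xs = All (λ a → All (λ b → a ≢ b → ¬ S (- (a + b))) xs) xs

Covering : Subset → List F243 → Set
Covering S xs = ∀ x → ¬ S x → Any (λ y → S (- (x + y))) xs

module _ {S : Subset} {xs : List F243} (enum : Enumerates xs S) where

  lineFree⇒isCapSet : LineFree S xs → IsCapSet S
  lineFree⇒isCapSet lineFree a b c Sa Sb Sc a≢b _ _ a+b+c≡𝟘 =
    All.lookup (All.lookup lineFree (to (enum a) Sa)) (to (enum b) Sb) a≢b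
      (subst S (x+y≡𝟘⇒y≡-x (a + b) c a+b+c≡𝟘) Sc)

  covering⇒maximal : Decidable S → Covering S xs →
    ∀ T → IsCapSet T → S ⊆ T → T ⊆ S
  covering⇒maximal S? covering T capT S⊆T x Tx = decidable-stable (S? x) λ ¬Sx →
    let y , y∈xs , Sz = find (covering x ¬Sx)
        Sy = from (enum y) y∈xs
        x≢S : ∀ {w} → S w → x ≢ w
        x≢S Sw x≡w = ¬Sx (subst S (sym x≡w) Sw)
    in capT x y (- (x + y)) Tx (S⊆T y Sy) (S⊆T _ Sz)
         (x≢S Sy) (x≢S Sz) (λ y≡z → x≢S Sy (y≡-[x+y]⇒x≡y x y y≡z)) (+-inverseʳ (x + y))

module _ {S T : Subset} (S≐T : S ≐ T) where

  isCompleteCapSet-resp-≐ : IsCompleteCapSet S → IsCompleteCapSet T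
  isCompleteCapSet-resp-≐ (capS , maximalS) = capT , maximalT
    where
    capT : IsCapSet T
    capT a b c Ta Tb Tc = capS a b c (proj₂ S≐T Ta) (proj₂ S≐T Tb) (proj₂ S≐T Tc)
    maximalT : ∀ U → IsCapSet U → T ⊆ U → U ⊆ T
    maximalT U capU T⊆U x Ux =
      proj₁ S≐T (maximalS U capU (λ y Sy → T⊆U y (proj₁ S≐T Sy)) x Ux)

  hasSize-resp-≐ : ∀ {n} → HasSize S n → HasSize T n
  hasSize-resp-≐ (xs , unique , length≡ , enum) =
    xs , unique , length≡ , λ x → mk⇔ (λ Tx → to (enum x) (proj₂ S≐T Tx))
                                      (λ x∈xs → proj₁ S≐T (from (enum x) x∈xs))

SameCoset : Subset → List F243 → List F243 → Set
SameCoset S gs xs = All (λ a → All S (map (a *_) gs) × All (_∈ map (a *_) gs) xs) xs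

sameCoset⇒coset≐ : ∀ {S gs xs} → Enumerates gs G → Enumerates xs S → SameCoset S gs xs →
  ∀ a → S a → coset a ≐ S
sameCoset⇒coset≐ {S} enumG enumS sameCoset a Sa = coset⊆S , S⊆coset
  where
  products = All.lookup sameCoset (to (enumS a) Sa)
  coset⊆S : ∀ {x} → coset a x → S x
  coset⊆S (g , Gg , refl) = All.lookup (proj₁ products) (∈-map⁺ (a *_) (to (enumG g) Gg))
  S⊆coset : ∀ {x} → S x → coset a x
  S⊆coset {x} Sx =
    let g , g∈gs , x≡ag = ∈-map⁻ (a *_) (All.lookup (proj₂ products) (to (enumS x) Sx))
    in g , from (enumG g) g∈gs , x≡ag

∀₃? : ∀ {p} {P : Pred F₃ p} → Decidable P → Dec (∀ a → P a)
∀₃? P? = map′ (λ { (p0 , p1 , p2) → λ { z0 → p0 ; z1 → p1 ; z2 → p2 } })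
              (λ p → p z0 , p z1 , p z2)
              (P? z0 ×-dec P? z1 ×-dec P? z2)

∀? : ∀ {p} {P : Pred F243 p} → Decidable P → Dec (∀ x → P x)
∀? P? = map′ (λ p → λ { (el a b c d e) → p a b c d e })
             (λ p a b c d e → p (el a b c d e))
             (∀₃? λ a → ∀₃? λ b → ∀₃? λ c → ∀₃? λ d → ∀₃? λ e → P? (el a b c d e))

data Table₃ {p} (P : F₃ → Set p) : Set p where
  table₃ : P z0 → P z1 → P z2 → Table₃ P

Table : ∀ {p} → Pred F243 p → Set p
Table P = Table₃ λ a → Table₃ λ b → Table₃ λ c → Table₃ λ d → Table₃ λ e → P (el a b c d e)

module _ {p} {P : F₃ → Set p} where

  lookup₃ : Table₃ P → ∀ a → P a
  lookup₃ (table₃ p0 _ _) z0 = p0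
  lookup₃ (table₃ _ p1 _) z1 = p1
  lookup₃ (table₃ _ _ p2) z2 = p2

  tabulate₃ : (∀ a → P a) → Table₃ P
  tabulate₃ f = table₃ (f z0) (f z1) (f z2)

module _ {p} {P : Pred F243 p} where

  lookup : Table P → ∀ x → P x
  lookup T (el a b c d e) = lookup₃ (lookup₃ (lookup₃ (lookup₃ (lookup₃ T a) b) c) d) e

  tabulate : (∀ x → P x) → Table P
  tabulate f =
    tabulate₃ λ a → tabulate₃ λ b → tabulate₃ λ c → tabulate₃ λ d → tabulate₃ λ e → f (el a b c d e)

  -- memo f is f; but once memo f is shared, each f x is evaluated at most once,
  -- which is what keeps the decisions below fast.
  memo : (∀ x → P x) → ∀ x → P x
  memo f = lookup (tabulate f)

F₃-elements : List F₃
F₃-elements = z0 ∷ z1 ∷ z2 ∷ []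

∈-F₃-elements : ∀ a → a ∈ F₃-elements
∈-F₃-elements z0 = here refl
∈-F₃-elements z1 = there (here refl)
∈-F₃-elements z2 = there (there (here refl))

applyAll : ∀ {A : Set} → List (F₃ → A) → List A
applyAll fs = cartesianProductWith _$_ fs F₃-elements

∈-applyAll : ∀ {A : Set} {fs : List (F₃ → A)} {f} → f ∈ fs → ∀ a → f a ∈ applyAll fs
∈-applyAll f∈fs a = ∈-cartesianProductWith⁺ _$_ f∈fs (∈-F₃-elements a)

elements : List F243
elements = applyAll (applyAll (applyAll (applyAll (map el F₃-elements))))

∈-elements : ∀ x → x ∈ elements
∈-elements (el a b c d e) =
  ∈-applyAll (∈-applyAll (∈-applyAll (∈-applyAll (∈-map⁺ el (∈-F₃-elements a)) b) c) d) e

module _ {S : Subset} (S? : Decidable S) where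

  lineFree? : ∀ xs → Dec (LineFree S xs)
  lineFree? xs = all? (λ a → all? (λ b → ¬? (a ≟ b) →-dec ¬? (S? (- (a + b)))) xs) xs

  covering? : ∀ xs → Dec (Covering S xs)
  covering? xs = ∀? λ x → ¬? (S? x) →-dec any? (λ y → S? (- (x + y))) xs

  sameCoset? : ∀ gs xs → Dec (SameCoset S gs xs)
  sameCoset? gs xs = all? (λ a → all? S? (map (a *_) gs) ×-dec all? (_∈? map (a *_) gs) xs) xs

χ : F243 → F243
χ x = x ^ 22

Fibre : F243 → Subset
Fibre c x = χ x ≡ c

fibre? : ∀ c → Decidable (Fibre c)
fibre? c = memo λ x → χ x ≟ c

fibre : F243 → List F243
fibre c = filter (fibre? c) elements

fibre-enumerates : ∀ c → Enumerates (fibre c) (Fibre c)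
fibre-enumerates c x =
  mk⇔ (∈-filter⁺ (fibre? c) (∈-elements x)) (λ x∈fibre → proj₂ (∈-filter⁻ (fibre? c) {xs = elements} x∈fibre))

t : F243
t = el z0 z1 z0 z0 z0

rep : Fin 11 → F243
rep i = t ^ toℕ i

μ : Fin 11 → F243
μ i = χ (rep i)

FibreFacts : F243 → List F243 → List F243 → Set
FibreFacts c gs xs =
  Unique xs × length xs ≡ 22 × LineFree (Fibre c) xs × Covering (Fibre c) xs × SameCoset (Fibre c) gs xs

-- The fibre and its memoised membership test are passed as arguments so that
-- all five checks share them.
fibreFacts? : ∀ gs c → Dec (FibreFacts c gs (fibre c))
fibreFacts? gs c = withTest (fibre? c)
  where
  withList : Decidable (Fibre c) → ∀ xs → Dec (FibreFacts c gs xs)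
  withList S? xs = unique? xs ×-dec length xs ℕ.≟ 22 ×-dec lineFree? S? xs ×-dec covering? S? xs
                   ×-dec sameCoset? S? gs xs
  withTest : (S? : Decidable (Fibre c)) → Dec (FibreFacts c gs (filter S? elements))
  withTest S? = withList S? (filter S? elements)

fibre-facts : ∀ i → FibreFacts (μ i) (fibre 𝟙) (fibre (μ i))
fibre-facts = from-yes (allFibres? (fibre 𝟙))
  where
  allFibres? : ∀ gs → Dec (∀ i → FibreFacts (μ i) gs (fibre (μ i)))
  allFibres? gs = Fin.all? λ i → fibreFacts? gs (μ i)

χ-image : ∀ x → x ≢ 𝟘 → ∃ λ i → χ x ≡ μ i
-- Tabulating μ shares its eleven values between the 243 queries.
χ-image x x≢𝟘 =
  let i , χx≡ = from-yes (image? (Vec.tabulate μ)) x x≢𝟘 in i , trans χx≡ (lookup∘tabulate μ i)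
  where
  image? : (ms : Vec.Vec F243 11) → Dec (∀ x → x ≢ 𝟘 → ∃ λ i → χ x ≡ Vec.lookup ms i)
  image? ms = ∀? λ x → ¬? (x ≟ 𝟘) →-dec among? (χ x)
    where
    among? : ∀ y → Dec (∃ λ i → y ≡ Vec.lookup ms i)
    among? y = Fin.any? λ i → y ≟ Vec.lookup ms i

μ-injective : ∀ i j → μ i ≡ μ j → i ≡ j
μ-injective = from-yes (Fin.all? λ i → Fin.all? λ j → μ i ≟ μ j →-dec i Fin.≟ j)

rep≢𝟘 : ∀ i → rep i ≢ 𝟘
rep≢𝟘 = from-yes (Fin.all? λ i → ¬? (rep i ≟ 𝟘))

coset≐Fibre : ∀ i a → Fibre (μ i) a → coset a ≐ Fibre (μ i)
coset≐Fibre i a Fa =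
  let _ , _ , _ , _ , sameCoset = fibre-facts i
  in sameCoset⇒coset≐ (fibre-enumerates 𝟙) (fibre-enumerates (μ i)) sameCoset a Fa

fibre-isCompleteCapSet : ∀ i → IsCompleteCapSet (Fibre (μ i))
fibre-isCompleteCapSet i =
  let _ , _ , lineFree , covering , _ = fibre-facts i
      enum = fibre-enumerates (μ i)
  in lineFree⇒isCapSet enum lineFree , covering⇒maximal enum (fibre? (μ i)) covering

fibre-hasSize : ∀ i → HasSize (Fibre (μ i)) 22
fibre-hasSize i =
  let unique , length≡ , _ = fibre-facts i in fibre (μ i) , unique , length≡ , fibre-enumerates (μ i)

mainTheorem7 :
    -- every coset of G_{243,22} in F₂₄₃ˣ is a complete cap set of size 22
    ((a : F243) → a ≢ 𝟘 → IsCompleteCapSet (coset a) × HasSize (coset a) 22)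
    ×
    -- the cosets are exactly 11 in number and partition F₂₄₃ˣ:
    -- there are representatives a₀ … a₁₀ ∈ F₂₄₃ˣ such that every nonzero x
    -- lies in exactly one coset aᵢ·G
    Σ (Fin 11 → F243) λ rep →
      ((i : Fin 11) → rep i ≢ 𝟘)
      × ((x : F243) → x ≢ 𝟘 →
           Σ (Fin 11) λ i → coset (rep i) x × ((j : Fin 11) → coset (rep j) x → j ≡ i))
mainTheorem7 = cosets , rep , rep≢𝟘 , partition
  where
  cosets : (a : F243) → a ≢ 𝟘 → IsCompleteCapSet (coset a) × HasSize (coset a) 22
  cosets a a≢𝟘 =
    let i , χa≡μi = χ-image a a≢𝟘
        Fibre≐coset = swap (coset≐Fibre i a χa≡μi)
    in isCompleteCapSet-resp-≐ Fibre≐coset (fibre-isCompleteCapSet i)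
     , hasSize-resp-≐ Fibre≐coset (fibre-hasSize i)
  partition : (x : F243) → x ≢ 𝟘 →
    Σ (Fin 11) λ i → coset (rep i) x × ((j : Fin 11) → coset (rep j) x → j ≡ i)
  -- x is passed explicitly: inferring it from χ x ≡ μ i would make Agda unfold x²².
  partition x x≢𝟘 =
    let i , χx≡μi = χ-image x x≢𝟘
        χx≡μ : ∀ j → coset (rep j) x → χ x ≡ μ j
        χx≡μ j = proj₁ (coset≐Fibre j (rep j) refl) {x}
    in i , proj₂ (coset≐Fibre i (rep i) refl) {x} χx≡μi
         , λ j x∈repⱼG → μ-injective j i (trans (sym (χx≡μ j x∈repⱼG)) χx≡μi)
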